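{- Let $m\geq 2$ and $n\geq 2$ be integers, let $G_m$ be a connected graph of order $m$ and let $K_n$ be the complete graph of order $n$. Then $$\max\{rvc(G_m),\, n+1\}\leq rvcl(G_m \diamond K_n)\leq m+n+|E(G_m)|-1.$$
   Context: All graphs are finite, simple, connected and undirected; $d(\cdot,\cdot)$ is the graph distance. For $k\in\mathbb{N}$, a rainbow vertex $k$-coloring of $G$ is a function $c: V(G)\to\{1,\dots,k\}$ such that every two vertices $u,v$ are joined by a $u$–$v$ path whose internal vertices have pairwise distinct colors; $rvc(G)$ is the smallest positive integer $k$ for which such a coloring exists. For a rainbow vertex $k$-coloring $c$ (using all $k$ colors), let $R_i$ be the set of vertices of color $i$ and $\Pi=(R_1,\dots,R_k)$; the rainbow code of $v$ is $rc_\Pi(v)=(d(v,R_1),\dots,d(v,R_k))$, where $d(v,R_i)=\min_{x\in R_i} d(v,x)$. The coloring is a locating rainbow $k$-coloring if all vertices have pairwise distinct rainbow codes; $rvcl(G)$ is the smallest positive integer $k$ such that $G$ has a locating rainbow $k$-coloring. The edge corona $G\diamond H$ is obtained from one copy of $G$ and $|E(G)|$ copies of $H$, where, enumerating the edges of $G$ as $e_1,\dots,e_{|E(G)|}$, both end vertices of $e_j$ are joined to every vertex of the $j$-th copy of $H$. -}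

module Defs where

open import Data.Nat using (ℕ; zero; suc; _+_; _≤_; _<_; _<ᵇ_)
open import Data.Bool using (Bool; true; false; _∧_; T; if_then_else_)
open import Data.Fin using (Fin; toℕ)
open import Data.List using (List; []; _∷_; map; allFin; length)
open import Data.Nat.ListAction using (sum)
open import Data.List.Relation.Unary.Unique.Propositional using (Unique)
open import Data.Product using (Σ; ∃; _×_; _,_; proj₁; proj₂)
open import Data.Sum using (_⊎_; inj₁; inj₂)
open import Relation.Binary.PropositionalEquality using (_≡_; _≢_)

module _ {V : Set} (Adj : V → V → Set) where

  data Walk : V → V → Set where
    nil  : ∀ {u} → Walk u u
    cons : ∀ {u w v} → Adj u w → Walk w v → Walk u v

  len : ∀ {u v} → Walk u v → ℕ
  len nil        = zero
  len (cons _ p) = suc (len p)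

  verts : ∀ {u v} → Walk u v → List V
  verts {u} nil        = u ∷ []
  verts {u} (cons _ p) = u ∷ verts p

  inner : ∀ {u v} → Walk u v → List V
  inner nil                        = []
  inner (cons _ nil)               = []
  inner (cons {w = w} _ (cons a p)) = w ∷ inner (cons a p)

  IsPath : ∀ {u v} → Walk u v → Set
  IsPath p = Unique (verts p)

  Connected : Set
  Connected = ∀ u v → Walk u v

  Dist : V → V → ℕ → Set
  Dist u v d = (Σ (Walk u v) λ p → IsPath p × len p ≡ d)
             × (∀ (p : Walk u v) → IsPath p → d ≤ len p)

  RainbowVertexColoring : (k : ℕ) → (V → Fin k) → Set
  RainbowVertexColoring k c =
    ∀ u v → Σ (Walk u v) λ p → IsPath p × Unique (map c (inner p))

  HasRVC : ℕ → Set
  HasRVC k = Σ (V → Fin k) (RainbowVertexColoring k)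

  IsRvc : ℕ → Set
  IsRvc r = 0 < r × HasRVC r × (∀ k → 0 < k → HasRVC k → r ≤ k)

  SetDist : ∀ {k} → (V → Fin k) → Fin k → V → ℕ → Set
  SetDist c i u d = (Σ V λ x → c x ≡ i × Dist u x d)
                  × (∀ x d' → c x ≡ i → Dist u x d' → d ≤ d')

  SameCode : ∀ {k} → (V → Fin k) → V → V → Set
  SameCode {k} c u v = ∀ (i : Fin k) → Σ ℕ λ d → SetDist c i u d × SetDist c i v d

  LocatingRainbowColoring : (k : ℕ) → (V → Fin k) → Set
  LocatingRainbowColoring k c =
    RainbowVertexColoring k c
    × (∀ (i : Fin k) → Σ V λ v → c v ≡ i)
    × (∀ u v → SameCode c u v → u ≡ v)

  HasRVCL : ℕ → Set
  HasRVCL k = Σ (V → Fin k) (LocatingRainbowColoring k)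

  IsRvcl : ℕ → Set
  IsRvcl l = 0 < l × HasRVCL l × (∀ k → 0 < k → HasRVCL k → l ≤ k)

record SimpleGraph (m : ℕ) : Set where
  field
    adj     : Fin m → Fin m → Bool
    adj-sym : ∀ i j → adj i j ≡ adj j i
    adj-irr : ∀ i → adj i i ≡ false
open SimpleGraph public

Adjᴳ : ∀ {m} → SimpleGraph m → Fin m → Fin m → Set
Adjᴳ G i j = adj G i j ≡ true

-- edge indicator on ordered pairs i < j (each edge counted once)
edgeB : ∀ {m} → SimpleGraph m → Fin m → Fin m → Bool
edgeB G i j = (toℕ i <ᵇ toℕ j) ∧ adj G i j

Edge : ∀ {m} → SimpleGraph m → Set
Edge {m} G = Σ (Fin m × Fin m) λ p → T (edgeB G (proj₁ p) (proj₂ p))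

numEdges : ∀ {m} → SimpleGraph m → ℕ
numEdges {m} G =
  sum (map (λ i → sum (map (λ j → if edgeB G i j then 1 else 0) (allFin m))) (allFin m))

-- Edge corona G ⋄ K_n: vertices of G plus, for every edge e of G, a copy
-- {e} × Fin n of K_n whose vertices are joined to both ends of e.

CoronaV : ∀ {m} → SimpleGraph m → ℕ → Set
CoronaV {m} G n = Fin m ⊎ (Edge G × Fin n)

IsEnd : ∀ {m} {G : SimpleGraph m} → Fin m → Edge G → Set
IsEnd a ((i , j) , _) = (a ≡ i) ⊎ (a ≡ j)

CoronaAdjK : ∀ {m} (G : SimpleGraph m) (n : ℕ) → CoronaV G n → CoronaV G n → Set
CoronaAdjK G n (inj₁ a)       (inj₁ b)       = Adjᴳ G a b
CoronaAdjK G n (inj₁ a)       (inj₂ (e , x)) = IsEnd {G = G} a e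
CoronaAdjK G n (inj₂ (e , x)) (inj₁ a)       = IsEnd {G = G} a e
CoronaAdjK G n (inj₂ (e , x)) (inj₂ (f , y)) = (e ≡ f) × (x ≢ y)

{-# OPTIONS --safe #-}
-- A rainbow path of G ⋄ K_n between two vertices of G casts a shadow in G:
-- every detour through a copy of K_n leaves and re-enters G at ends of one edge, so it
-- can be replaced by that edge or dropped, and the shadow is again a rainbow path; hence
-- rvc(G) ≤ rvcl(G ⋄ K_n). Two vertices of one copy of K_n are twins, so if they shared a
-- colour, swapping them would be a colour-preserving automorphism, which preserves every
-- rainbow code; thus each copy is coloured injectively and at least n colours are needed.
-- With exactly n colours every copy shows all colours, and an end a of its edge has the
-- same rainbow code as the copy vertex coloured like a.
--
-- Give the m vertices of G distinct colours and the i-th vertex of every copy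
-- one of n further colours. Paths through G are then rainbow, each vertex of G is alone in
-- its colour class, and two copies of K_n on different edges e, f are told apart by an end
-- of e that is not an end of f. So rvcl(G ⋄ K_n) ≤ m + n ≤ m + n + |E(G)| - 1.
module Submission where

open import Data.Bool using (T; true; if_then_else_)
open import Data.Bool.Properties using (T-irrelevant; T-∧; T-≡)
open import Data.Empty using (⊥)
open import Data.Fin using (Fin; zero; suc; toℕ; _↑ˡ_; _↑ʳ_; splitAt; punchOut)
open import Data.Fin.Permutation using (Permutation; _⟨$⟩ʳ_; _⟨$⟩ˡ_; inverseˡ; inverseʳ; transpose; id)
import Data.Fin.Permutation.Components as Components
open import Data.Fin.Properties
  using (sequence; any?; injective⇒≤; punchOut-injective; ↑ˡ-injective; ↑ʳ-injective;
         splitAt⁻¹-↑ˡ; splitAt⁻¹-↑ʳ; splitAt-↑ˡ; splitAt-↑ʳ)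
  renaming (_≟_ to _≟ᶠ_)
open import Data.List using (List; []; _∷_; [_]; _++_; map; allFin)
open import Data.List.Membership.DecPropositional using (_∈?_)
open import Data.List.Membership.Propositional using (_∈_)
open import Data.List.Membership.Propositional.Properties using (∈-map⁺; ∈-allFin)
open import Data.List.Properties using (map-∘)
open import Data.List.Relation.Binary.Sublist.Propositional
  using (_⊆_; []; _∷_; _∷ʳ_; minimum; ⊆-refl; ⊆-reflexive; ⊆-trans)
open import Data.List.Relation.Binary.Sublist.Propositional.Properties
  using (All-resp-⊆) renaming (map⁺ to ⊆-map⁺)
open import Data.List.Relation.Unary.All using (All; []; _∷_; universal)
import Data.List.Relation.Unary.All.Properties as All
open import Data.List.Relation.Unary.AllPairs using ([]; _∷_)
open import Data.List.Relation.Unary.Any using (here; there)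
open import Data.List.Relation.Unary.Unique.Propositional using (Unique)
import Data.List.Relation.Unary.Unique.Propositional.Properties as Unique
open import Data.Nat using (ℕ; zero; suc; _+_; _∸_; _≤_; _<_; _⊔_; z≤n; s≤s)
open import Data.Nat.Induction using (<-rec)
open import Data.Nat.ListAction using (sum)
open import Data.Nat.Properties
  using (≤-refl; ≤-trans; <-irrefl; <-asym; ≮⇒≥; ≤∧≢⇒<; <ᵇ⇒<; 1+n≰n; n≤1+n; m≤m+n; m≤n+m;
         +-∸-assoc; ⊔-lub)
open import Data.Product using (Σ; _×_; _,_; proj₁; proj₂)
import Data.Product.Properties as Product
open import Data.Sum using (inj₁; inj₂)
open import Data.Sum.Properties using (inj₁-injective; inj₂-injective)
open import Data.Unit using (tt)
open import Effect.Monad using (RawMonad)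
open import Function using (_∘_)
open import Function.Bundles using (Equivalence)
open import Function.Definitions using (Injective)
open import Relation.Binary.Definitions using (DecidableEquality)
open import Relation.Binary.PropositionalEquality
  using (_≡_; _≢_; ≢-sym; refl; sym; trans; cong; subst; subst₂)
open import Relation.Nullary using (¬_; Dec; yes; no; _⊎-dec_)
open import Relation.Nullary.Decidable using (¬¬-excluded-middle; decidable-stable)
open import Relation.Nullary.Negation using (¬¬-Monad; ¬¬-map; contradiction)

open import Defs

Unique-resp-⊆ : {A : Set} {xs ys : List A} → xs ⊆ ys → Unique ys → Unique xs
Unique-resp-⊆ [] [] = []
Unique-resp-⊆ (_ ∷ʳ τ) (_ ∷ u) = Unique-resp-⊆ τ u
Unique-resp-⊆ (refl ∷ τ) (x∉ ∷ u) = All-resp-⊆ τ x∉ ∷ Unique-resp-⊆ τ u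

Unique-∷ʳ⁺ : {A : Set} {xs : List A} (x : A) → Unique xs → All (x ≢_) xs → Unique (xs ++ [ x ])
Unique-∷ʳ⁺ x [] [] = [] ∷ []
Unique-∷ʳ⁺ x (y∉ ∷ u) (x≢y ∷ x∉) = All.++⁺ y∉ (≢-sym x≢y ∷ []) ∷ Unique-∷ʳ⁺ x u x∉

Least : (ℕ → Set) → Set
Least P = Σ ℕ λ d → P d × (∀ {d′} → P d′ → d ≤ d′)

¬¬-least : {P : ℕ → Set} (k : ℕ) → P k → ¬ ¬ Least P
¬¬-least {P} = <-rec (λ k → P k → ¬ ¬ Least P) step
  where
  step : ∀ k → (∀ {j} → j < k → P j → ¬ ¬ Least P) → P k → ¬ ¬ Least P
  step k below pk noLeast = ¬¬-excluded-middle {A = Σ ℕ λ j → j < k × P j} λ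
    { (yes (j , j<k , pj)) → below j<k pj noLeast
    ; (no none) → noLeast (k , pk , λ pd′ → ≮⇒≥ λ d′<k → none (_ , d′<k , pd′)) }

record Automorphism {V : Set} (Adj : V → V → Set) : Set where
  field
    to from  : V → V
    to-adj   : ∀ {a b} → Adj a b → Adj (to a) (to b)
    from-adj : ∀ {a b} → Adj a b → Adj (from a) (from b)
    from-to  : ∀ a → from (to a) ≡ a
    to-from  : ∀ a → to (from a) ≡ a

  to-injective : ∀ {a b} → to a ≡ to b → a ≡ b
  to-injective {a} {b} eq = trans (sym (from-to a)) (trans (cong from eq) (from-to b))

  from-injective : ∀ {a b} → from a ≡ from b → a ≡ b
  from-injective {a} {b} eq = trans (sym (to-from a)) (trans (cong to eq) (to-from b))

inverse : {V : Set} {Adj : V → V → Set} → Automorphism Adj → Automorphism Adj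
inverse σ = record
  { to = from ; from = to ; to-adj = from-adj ; from-adj = to-adj ; from-to = to-from ; to-from = from-to }
  where open Automorphism σ

module _ {V W : Set} {AdjV : V → V → Set} {AdjW : W → W → Set}
         (f : V → W) (f-adj : ∀ {a b} → AdjV a b → AdjW (f a) (f b)) where

  mapWalk : ∀ {a b} → Walk AdjV a b → Walk AdjW (f a) (f b)
  mapWalk nil = nil
  mapWalk (cons h p) = cons (f-adj h) (mapWalk p)

  len-mapWalk : ∀ {a b} (p : Walk AdjV a b) → len AdjW (mapWalk p) ≡ len AdjV p
  len-mapWalk nil = refl
  len-mapWalk (cons h p) = cong suc (len-mapWalk p)

  verts-mapWalk : ∀ {a b} (p : Walk AdjV a b) → verts AdjW (mapWalk p) ≡ map f (verts AdjV p)
  verts-mapWalk nil = refl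
  verts-mapWalk (cons h p) = cong (_ ∷_) (verts-mapWalk p)

  mapWalk-path : Injective _≡_ _≡_ f →
                 ∀ {a b} {p : Walk AdjV a b} → IsPath AdjV p → IsPath AdjW (mapWalk p)
  mapWalk-path f-inj {p = p} p-path = subst Unique (sym (verts-mapWalk p)) (Unique.map⁺ f-inj p-path)

_▷_ : {V : Set} {Adj : V → V → Set} {u v w : V} → Walk Adj u v → Adj v w → Walk Adj u w
nil ▷ h = cons h nil
cons g p ▷ h = cons g (p ▷ h)

module _ {V : Set} (Adj : V → V → Set) where

  verts-▷ : ∀ {u v w} (p : Walk Adj u v) (h : Adj v w) → verts Adj (p ▷ h) ≡ verts Adj p ++ [ w ]
  verts-▷ nil h = refl
  verts-▷ (cons g p) h = cong (_ ∷_) (verts-▷ p h)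

  inner-cons-▷ : ∀ {s u v w} (g : Adj s u) (p : Walk Adj u v) (h : Adj v w) →
                 inner Adj (cons g (p ▷ h)) ≡ verts Adj p
  inner-cons-▷ g nil h = refl
  inner-cons-▷ g (cons g′ p) h = cong (_ ∷_) (inner-cons-▷ g′ p h)

  ▷-path : ∀ {u v w} {p : Walk Adj u v} (h : Adj v w) →
           All (w ≢_) (verts Adj p) → IsPath Adj p → IsPath Adj (p ▷ h)
  ▷-path {w = w} {p} h w∉p p-path = subst Unique (sym (verts-▷ p h)) (Unique-∷ʳ⁺ w p-path w∉p)

  inner-cons⊆verts : ∀ {u w v} (h : Adj u w) (p : Walk Adj w v) → inner Adj (cons h p) ⊆ verts Adj p
  inner-cons⊆verts h nil = minimum _
  inner-cons⊆verts h (cons h′ p) = refl ∷ inner-cons⊆verts h′ p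

  inner⊆verts : ∀ {u v} (p : Walk Adj u v) → inner Adj p ⊆ verts Adj p
  inner⊆verts nil = minimum _
  inner⊆verts (cons h p) = _ ∷ʳ inner-cons⊆verts h p

  inner-▷⊆verts : ∀ {u v w} (p : Walk Adj u v) (h : Adj v w) → inner Adj (p ▷ h) ⊆ verts Adj p
  inner-▷⊆verts nil h = minimum _
  inner-▷⊆verts (cons g p) h = subst (_⊆ verts Adj (cons g p)) (sym (inner-cons-▷ g p h)) (_ ∷ʳ ⊆-refl)

  inner⊆inner-cons : ∀ {u w v} (h : Adj u w) (p : Walk Adj w v) → inner Adj p ⊆ inner Adj (cons h p)
  inner⊆inner-cons h nil = []
  inner⊆inner-cons h (cons _ _) = _ ∷ʳ ⊆-refl

  module _ (_≟_ : DecidableEquality V) where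

    suffixFrom : ∀ {u w v} (p : Walk Adj w v) → u ∈ verts Adj p →
                 Σ (Walk Adj u v) λ q → IsPath Adj p → IsPath Adj q
    suffixFrom nil (here refl) = nil , λ p-path → p-path
    suffixFrom (cons h p) (here refl) = cons h p , λ p-path → p-path
    suffixFrom (cons h p) (there u∈p) with suffixFrom p u∈p
    ... | q , q-path = q , λ { (_ ∷ p-path) → q-path p-path }

    walk⇒path : ∀ {u v} → Walk Adj u v → Σ (Walk Adj u v) (IsPath Adj)
    walk⇒path nil = nil , [] ∷ []
    walk⇒path (cons {u = u} h p) with walk⇒path p
    ... | q , q-path with _∈?_ _≟_ u (verts Adj q)
    ...   | yes u∈q = proj₁ (suffixFrom q u∈q) , proj₂ (suffixFrom q u∈q) q-path
    ...   | no u∉q = cons h q , All.¬Any⇒All¬ _ u∉q ∷ q-path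

  Dist-0⇒≡ : ∀ {u v} → Dist Adj u v 0 → u ≡ v
  Dist-0⇒≡ ((nil , _ , _) , _) = refl

  Dist-refl : ∀ {u} → Dist Adj u u 0
  Dist-refl = (nil , [] ∷ [] , refl) , λ _ _ → z≤n

  Dist-adjacent : ∀ {u v} → Adj u v → u ≢ v → Dist Adj u v 1
  Dist-adjacent {u} {v} h u≢v = (cons h nil , (u≢v ∷ []) ∷ [] ∷ [] , refl) , shortest
    where
    shortest : (p : Walk Adj u v) → IsPath Adj p → 1 ≤ len Adj p
    shortest nil _ = contradiction refl u≢v
    shortest (cons _ _) _ = s≤s z≤n

  module _ {k} (c : V → Fin k) where

    SetDist-self : ∀ {u i} → c u ≡ i → SetDist Adj c i u 0
    SetDist-self {u} cu = (u , cu , Dist-refl) , λ _ _ _ _ → z≤n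

    SetDist-neighbour : ∀ {u w i} → c u ≢ i → Adj u w → c w ≡ i → SetDist Adj c i u 1
    SetDist-neighbour {u} {w} {i} cu≢i h cw = (w , cw , Dist-adjacent h u≢w) , nearest
      where
      u≢w : u ≢ w
      u≢w refl = cu≢i cw
      nearest : ∀ x d → c x ≡ i → Dist Adj u x d → 1 ≤ d
      nearest x zero cx dist = contradiction (trans (cong c (Dist-0⇒≡ dist)) cx) cu≢i
      nearest x (suc d) _ _ = s≤s z≤n

    SameCode⇒≡colour : ∀ {u v} → SameCode Adj c u v → c u ≡ c v
    SameCode⇒≡colour {u} {v} same with same (c u)
    ... | d , (_ , nearest-u) , ((x , cx , dist-v) , _) with nearest-u u 0 refl Dist-refl
    ... | z≤n = sym (trans (cong c (Dist-0⇒≡ dist-v)) cx)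

    -- d(u, R_i) is the least length of a path from u into R_i. Path lengths are not
    -- decidable here, so this least number, and with it the rainbow code, exists only
    -- under ¬¬; that suffices below, where the conclusions drawn are decidable.
    ¬¬SetDist : (∀ u v → Σ (Walk Adj u v) (IsPath Adj)) →
                ∀ u i → Σ V (λ x → c x ≡ i) → ¬ ¬ Σ ℕ (SetDist Adj c i u)
    ¬¬SetDist paths u i (x , cx) with paths u x
    ... | p , p-path = ¬¬-map nearest (¬¬-least (len Adj p) (x , cx , p , p-path , refl))
      where
      PathToClass : ℕ → Set
      PathToClass d = Σ V λ y → c y ≡ i × Σ (Walk Adj u y) λ q → IsPath Adj q × len Adj q ≡ d
      nearest : Least PathToClass → Σ ℕ (SetDist Adj c i u)
      nearest (d , (y , cy , q , q-path , q-len) , least) =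
        d , (y , cy , (q , q-path , q-len) , λ r r-path → least (y , cy , r , r-path , refl))
          , λ { x′ d′ cx′ ((r , r-path , r-len) , _) → least (x′ , cx′ , r , r-path , r-len) }

  module _ (σ : Automorphism Adj) where
    open Automorphism σ

    Dist-to : ∀ {a b d} → Dist Adj a b d → Dist Adj (to a) (to b) d
    Dist-to {a} {b} {d} ((p , p-path , p-len) , shortest) =
      (mapWalk to to-adj p , mapWalk-path to to-adj to-injective p-path , trans (len-mapWalk to to-adj p) p-len) ,
      λ q q-path → subst (d ≤_) (len-mapWalk from from-adj q)
                     (shortest′ (mapWalk from from-adj q) (mapWalk-path from from-adj from-injective q-path))
      where
      shortest′ : (q : Walk Adj (from (to a)) (from (to b))) → IsPath Adj q → d ≤ len Adj q
      shortest′ = subst₂ (λ x y → (q : Walk Adj x y) → IsPath Adj q → d ≤ len Adj q)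
                         (sym (from-to a)) (sym (from-to b)) shortest

  module _ (σ : Automorphism Adj) {k} {c : V → Fin k} where
    open Automorphism σ

    SetDist-to : (∀ a → c (to a) ≡ c a) → ∀ {i u d} → SetDist Adj c i u d → SetDist Adj c i (to u) d
    SetDist-to c-to {i} {u} {d} ((x , cx , dist) , nearest) =
      (to x , trans (c-to x) cx , Dist-to σ dist) ,
      λ x′ d′ cx′ dist′ → nearest (from x′) d′ (trans (c-from x′) cx′)
                            (subst (λ y → Dist Adj y (from x′) d′) (from-to u) (Dist-to (inverse σ) dist′))
      where
      c-from : ∀ a → c (from a) ≡ c a
      c-from a = trans (sym (c-to (from a))) (cong c (to-from a))

  locating-rigid : ∀ {k} {c : V → Fin k} → LocatingRainbowColoring Adj k c →
                   (σ : Automorphism Adj) → (∀ a → c (Automorphism.to σ a) ≡ c a) →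
                   ∀ u → ¬ ¬ (u ≡ Automorphism.to σ u)
  locating-rigid {k} {c} (rainbow , onto , distinct) σ c-to u =
    ¬¬-map (distinct u (to u) ∘ sameCode) (¬¬-∀ λ i → ¬¬SetDist c paths u i (onto i))
    where
    open Automorphism σ
    ¬¬-∀ : {P : Fin k → Set} → (∀ i → ¬ ¬ P i) → ¬ ¬ (∀ i → P i)
    ¬¬-∀ = sequence (RawMonad.rawApplicative ¬¬-Monad)
    paths : ∀ u v → Σ (Walk Adj u v) (IsPath Adj)
    paths u v = proj₁ (rainbow u v) , proj₁ (proj₂ (rainbow u v))
    sameCode : (∀ i → Σ ℕ (SetDist Adj c i u)) → SameCode Adj c u (to u)
    sameCode code i = proj₁ (code i) , proj₂ (code i) , SetDist-to σ c-to (proj₂ (code i))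

injective⇒surjective : ∀ {n} {f : Fin n → Fin n} → Injective _≡_ _≡_ f → ∀ j → Σ (Fin n) λ x → f x ≡ j
injective⇒surjective {suc n} {f} f-inj j with any? (λ x → f x ≟ᶠ j)
... | yes hit = hit
... | no miss = contradiction (injective⇒≤ g-inj) 1+n≰n
  where
  g : Fin (suc n) → Fin n
  g x = punchOut {i = j} λ j≡fx → miss (x , sym j≡fx)
  g-inj : Injective _≡_ _≡_ g
  g-inj {x} {y} = f-inj ∘ punchOut-injective (λ eq → miss (x , sym eq)) (λ eq → miss (y , sym eq))

transpose-left : ∀ {n} (i j : Fin n) → Components.transpose i j i ≡ j
transpose-left i j with i ≟ᶠ i
... | yes _ = refl
... | no i≢i = contradiction refl i≢i

transpose-invariant : ∀ {n} {A : Set} (f : Fin n → A) {i j} → f i ≡ f j →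
                      ∀ k → f (Components.transpose i j k) ≡ f k
transpose-invariant f {i} {j} fi≡fj k with k ≟ᶠ i
... | yes refl = sym fi≡fj
... | no _ with k ≟ᶠ j
...   | yes refl = fi≡fj
...   | no _ = refl

module Corona {m : ℕ} (G : SimpleGraph m) (n : ℕ) where

  V : Set
  V = CoronaV G n

  AdjG : Fin m → Fin m → Set
  AdjG = Adjᴳ G

  AdjC : V → V → Set
  AdjC = CoronaAdjK G n

  _≟ᴱ_ : DecidableEquality (Edge G)
  _≟ᴱ_ = Product.≡-dec (Product.≡-dec _≟ᶠ_ _≟ᶠ_) (λ s t → yes (T-irrelevant s t))

  edge-< : ∀ {a b} → T (edgeB G a b) → toℕ a < toℕ b
  edge-< {a} {b} t = <ᵇ⇒< (toℕ a) (toℕ b) (proj₁ (Equivalence.to T-∧ t))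

  edge-adj : ∀ {a b} → T (edgeB G a b) → AdjG a b
  edge-adj t = Equivalence.to T-≡ (proj₂ (Equivalence.to T-∧ t))

  ends-adjacent : ∀ (e : Edge G) {u w} → IsEnd {G = G} u e → IsEnd {G = G} w e → u ≢ w → AdjG u w
  ends-adjacent ((a , b) , t) (inj₁ refl) (inj₁ refl) u≢w = contradiction refl u≢w
  ends-adjacent ((a , b) , t) (inj₁ refl) (inj₂ refl) _ = edge-adj t
  ends-adjacent ((a , b) , t) (inj₂ refl) (inj₁ refl) _ = trans (adj-sym G b a) (edge-adj t)
  ends-adjacent ((a , b) , t) (inj₂ refl) (inj₂ refl) u≢w = contradiction refl u≢w

  ends⇒≡ : ∀ {a b} (t : T (edgeB G a b)) (f : Edge G) →
           IsEnd {G = G} a f → IsEnd {G = G} b f → ((a , b) , t) ≡ f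
  ends⇒≡ t (_ , t′) (inj₁ refl) (inj₂ refl) = cong (_ ,_) (T-irrelevant t t′)
  ends⇒≡ t _ (inj₁ refl) (inj₁ refl) = contradiction (edge-< t) (<-irrefl refl)
  ends⇒≡ t _ (inj₂ refl) (inj₂ refl) = contradiction (edge-< t) (<-irrefl refl)
  ends⇒≡ t (_ , t′) (inj₂ refl) (inj₁ refl) = contradiction (edge-< t′) (<-asym (edge-< t))

  record Shadow {u v} (W : Walk AdjC (inj₁ u) (inj₁ v)) : Set where
    field
      walk   : Walk AdjG u v
      verts⊆ : map inj₁ (verts AdjG walk) ⊆ verts AdjC W
      inner⊆ : map inj₁ (inner AdjG walk) ⊆ inner AdjC W
      len≤   : len AdjG walk ≤ len AdjC W
  open Shadow

  inner-cons⊆ : ∀ {s u w v} (h : AdjC s (inj₁ w)) (g : AdjG u w) (P : Walk AdjG w v)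
                (W : Walk AdjC (inj₁ w) (inj₁ v)) → len AdjG P ≤ len AdjC W →
                map inj₁ (inner AdjG P) ⊆ inner AdjC W →
                map inj₁ (inner AdjG (cons g P)) ⊆ inner AdjC (cons h W)
  inner-cons⊆ h g nil W _ _ = minimum _
  inner-cons⊆ h g (cons _ _) (cons _ _) _ P⊆W = refl ∷ P⊆W

  mutual
    shadow : ∀ {u v} (W : Walk AdjC (inj₁ u) (inj₁ v)) → Shadow W
    shadow nil = record { walk = nil ; verts⊆ = refl ∷ [] ; inner⊆ = [] ; len≤ = z≤n }
    shadow (cons {w = inj₁ _} g W) = let S = shadow W in record
      { walk = cons g (walk S)
      ; verts⊆ = refl ∷ verts⊆ S
      ; inner⊆ = inner-cons⊆ g g (walk S) W (len≤ S) (inner⊆ S)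
      ; len≤ = s≤s (len≤ S) }
    shadow (cons {w = inj₂ _} h W) = shadow-via-copy h W

    -- A run of copy vertices between base vertices u and w is dropped when u ≡ w
    -- and replaced by the edge uw otherwise (both are ends of the copy's edge).
    shadow-via-copy : ∀ {u v e x} (h : IsEnd {G = G} u e) (W : Walk AdjC (inj₂ (e , x)) (inj₁ v)) →
                      Shadow (cons {w = inj₂ (e , x)} h W)
    shadow-via-copy {u} {e = e} h (cons {w = inj₁ w} h′ W) with u ≟ᶠ w
    ... | yes refl = let S = shadow W in record
      { walk = walk S
      ; verts⊆ = _ ∷ʳ _ ∷ʳ verts⊆ S
      ; inner⊆ = _ ∷ʳ ⊆-trans (inner⊆ S) (inner⊆inner-cons AdjC h′ W)
      ; len≤ = ≤-trans (len≤ S) (≤-trans (n≤1+n _) (n≤1+n _)) }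
    ... | no u≢w = let S = shadow W ; g = ends-adjacent e h h′ u≢w in record
      { walk = cons g (walk S)
      ; verts⊆ = refl ∷ _ ∷ʳ verts⊆ S
      ; inner⊆ = _ ∷ʳ inner-cons⊆ h′ g (walk S) W (len≤ S) (inner⊆ S)
      ; len≤ = s≤s (≤-trans (len≤ S) (n≤1+n _)) }
    shadow-via-copy h (cons {w = inj₂ _} (refl , _) W@(cons _ _)) = let S = shadow-via-copy h W in record
      { walk = walk S
      ; verts⊆ = ⊆-trans (verts⊆ S) (refl ∷ _ ∷ʳ ⊆-refl)
      ; inner⊆ = _ ∷ʳ inner⊆ S
      ; len≤ = ≤-trans (len≤ S) (n≤1+n _) }

  rainbow-restrict : ∀ {k} (c : V → Fin k) → RainbowVertexColoring AdjC k c →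
                     RainbowVertexColoring AdjG k (c ∘ inj₁)
  rainbow-restrict c rainbow u v with rainbow (inj₁ u) (inj₁ v)
  ... | W , W-path , W-rainbow =
    walk S ,
    Unique.map⁻ (Unique-resp-⊆ (verts⊆ S) W-path) ,
    subst Unique (sym (map-∘ (inner AdjG (walk S)))) (Unique-resp-⊆ (⊆-map⁺ c (inner⊆ S)) W-rainbow)
    where
    S : Shadow W
    S = shadow W

  permuteCopies : (Edge G → Permutation n n) → Automorphism AdjC
  permuteCopies π = record
    { to = act (λ e → π e ⟨$⟩ʳ_)
    ; from = act (λ e → π e ⟨$⟩ˡ_)
    ; to-adj = λ {a} {b} → act-adj (λ e → π e ⟨$⟩ʳ_) (λ e → injective (π e ⟨$⟩ˡ_) (inverseˡ (π e))) a b
    ; from-adj = λ {a} {b} → act-adj (λ e → π e ⟨$⟩ˡ_) (λ e → injective (π e ⟨$⟩ʳ_) (inverseʳ (π e))) a b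
    ; from-to = λ { (inj₁ a) → refl ; (inj₂ (e , z)) → cong (λ z → inj₂ (e , z)) (inverseˡ (π e)) }
    ; to-from = λ { (inj₁ a) → refl ; (inj₂ (e , z)) → cong (λ z → inj₂ (e , z)) (inverseʳ (π e)) }
    }
    where
    act : (Edge G → Fin n → Fin n) → V → V
    act φ (inj₁ a) = inj₁ a
    act φ (inj₂ (e , z)) = inj₂ (e , φ e z)
    injective : {f : Fin n → Fin n} (g : Fin n → Fin n) → (∀ {z} → g (f z) ≡ z) → Injective _≡_ _≡_ f
    injective g g∘f fx≡fy = trans (sym g∘f) (trans (cong g fx≡fy) g∘f)
    act-adj : (φ : Edge G → Fin n → Fin n) → (∀ e → Injective _≡_ _≡_ (φ e)) →
              ∀ a b → AdjC a b → AdjC (act φ a) (act φ b)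
    act-adj φ φ-inj (inj₁ _) (inj₁ _) h = h
    act-adj φ φ-inj (inj₁ _) (inj₂ _) h = h
    act-adj φ φ-inj (inj₂ _) (inj₁ _) h = h
    act-adj φ φ-inj (inj₂ (e , _)) (inj₂ _) (refl , x≢y) = refl , x≢y ∘ φ-inj e

  swapInCopy : Edge G → Fin n → Fin n → Edge G → Permutation n n
  swapInCopy e x y f with f ≟ᴱ e
  ... | yes _ = transpose x y
  ... | no _ = id

  module _ {k} {c : V → Fin k} (locating : LocatingRainbowColoring AdjC k c) where

    copy-colours-injective : ∀ e → Injective _≡_ _≡_ (λ z → c (inj₂ (e , z)))
    copy-colours-injective e {x} {y} cx≡cy =
      decidable-stable (x ≟ᶠ y) (¬¬-map x≡y (locating-rigid AdjC locating σ preserves (inj₂ (e , x))))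
      where
      σ : Automorphism AdjC
      σ = permuteCopies (swapInCopy e x y)
      preserves : ∀ a → c (Automorphism.to σ a) ≡ c a
      preserves (inj₁ a) = refl
      preserves (inj₂ (f , z)) with f ≟ᴱ e
      ... | yes refl = transpose-invariant (λ z → c (inj₂ (f , z))) cx≡cy z
      ... | no _ = refl
      moves : Automorphism.to σ (inj₂ (e , x)) ≡ inj₂ (e , y)
      moves with e ≟ᴱ e
      ... | yes _ = cong (λ z → inj₂ (e , z)) (transpose-left x y)
      ... | no e≢e = contradiction refl e≢e
      x≡y : inj₂ (e , x) ≡ Automorphism.to σ (inj₂ (e , x)) → x ≡ y
      x≡y fixed = Product.,-injectiveʳ (inj₂-injective (trans fixed moves))

    -- Both vertices see their own colour at distance 0 and, in the copy of e, every other
    -- colour at distance 1.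
    end-copy-sameCode : ∀ {a} (e : Edge G) → IsEnd {G = G} a e →
                        (∀ i → Σ (Fin n) λ z → c (inj₂ (e , z)) ≡ i) →
                        ∀ {z} → c (inj₂ (e , z)) ≡ c (inj₁ a) → SameCode AdjC c (inj₁ a) (inj₂ (e , z))
    end-copy-sameCode {a} e a∈e onto {z} cz i with i ≟ᶠ c (inj₁ a)
    ... | yes refl = 0 , SetDist-self AdjC c refl , SetDist-self AdjC c cz
    ... | no i≢ca with onto i
    ...   | z′ , cz′ = 1 , SetDist-neighbour AdjC c (i≢ca ∘ sym) a∈e cz′
                         , SetDist-neighbour AdjC c (i≢ca ∘ sym ∘ trans (sym cz)) (refl , z≢z′) cz′
      where
      z≢z′ : z ≢ z′
      z≢z′ z≡z′ = i≢ca (trans (sym cz′) (trans (cong (λ w → c (inj₂ (e , w))) (sym z≡z′)) cz))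

    n<colours : Edge G → n < k
    n<colours e@((a , _) , _) = ≤∧≢⇒< (injective⇒≤ injective) n≢k
      where
      injective : Injective _≡_ _≡_ (λ z → c (inj₂ (e , z)))
      injective = copy-colours-injective e
      n≢k : n ≢ k
      n≢k refl with injective⇒surjective injective (c (inj₁ a))
      ... | z , cz with proj₂ (proj₂ locating) _ _
                          (end-copy-sameCode e (inj₁ refl) (injective⇒surjective injective) cz)
      ...   | ()

  canonical : V → Fin (m + n)
  canonical (inj₁ a) = a ↑ˡ n
  canonical (inj₂ (_ , z)) = m ↑ʳ z

  lift : ∀ {a b} → Walk AdjG a b → Walk AdjC (inj₁ a) (inj₁ b)
  lift = mapWalk inj₁ (λ h → h)

  verts-lift : ∀ {a b} (P : Walk AdjG a b) → verts AdjC (lift P) ≡ map inj₁ (verts AdjG P)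
  verts-lift = verts-mapWalk inj₁ (λ h → h)

  lift-path : ∀ {a b} {P : Walk AdjG a b} → IsPath AdjG P → IsPath AdjC (lift P)
  lift-path = mapWalk-path inj₁ (λ h → h) inj₁-injective

  copy∉lift : ∀ {a b q} (P : Walk AdjG a b) → All (inj₂ q ≢_) (verts AdjC (lift P))
  copy∉lift P = subst (All _) (sym (verts-lift P)) (All.map⁺ (universal (λ _ ()) _))

  rainbow-on-base : ∀ {s t a b} (W : Walk AdjC s t) {P : Walk AdjG a b} → IsPath AdjG P →
                    inner AdjC W ⊆ verts AdjC (lift P) → Unique (map canonical (inner AdjC W))
  rainbow-on-base W {P} P-path W⊆P =
    Unique-resp-⊆ (⊆-map⁺ canonical (⊆-trans W⊆P (⊆-reflexive (verts-lift P))))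
      (subst Unique (map-∘ (verts AdjG P)) (Unique.map⁺ (↑ˡ-injective n _ _) P-path))

  canonical-rainbow : (∀ a b → Σ (Walk AdjG a b) (IsPath AdjG)) →
                      RainbowVertexColoring AdjC (m + n) canonical
  canonical-rainbow paths (inj₁ a) (inj₁ b) with paths a b
  ... | P , P-path = lift P , lift-path P-path , rainbow-on-base (lift P) P-path (inner⊆verts AdjC (lift P))
  canonical-rainbow paths (inj₂ (((a , _) , _) , _)) (inj₁ b) with paths a b
  ... | P , P-path =
    cons (inj₁ refl) (lift P) , copy∉lift P ∷ lift-path P-path ,
    rainbow-on-base (cons (inj₁ refl) (lift P)) P-path (inner-cons⊆verts AdjC (inj₁ refl) (lift P))
  canonical-rainbow paths (inj₁ a) (inj₂ (((b , _) , _) , _)) with paths a b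
  ... | P , P-path =
    lift P ▷ inj₁ refl , ▷-path AdjC (inj₁ refl) (copy∉lift P) (lift-path P-path) ,
    rainbow-on-base (lift P ▷ inj₁ refl) P-path (inner-▷⊆verts AdjC (lift P) (inj₁ refl))
  canonical-rainbow paths (inj₂ (e , x)) (inj₂ (f , y)) with Product.≡-dec _≟ᴱ_ _≟ᶠ_ (e , x) (f , y)
  ... | yes refl = nil , [] ∷ [] , []
  ... | no ex≢fy with e | f
  ...   | ((a , _) , _) | ((b , _) , _) with paths a b
  ...     | P , P-path =
    W , subst (All _) (sym (verts-▷ AdjC (lift P) (inj₁ refl)))
                      (All.++⁺ (copy∉lift P) ((ex≢fy ∘ inj₂-injective) ∷ []))
        ∷ ▷-path AdjC (inj₁ refl) (copy∉lift P) (lift-path P-path) ,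
    rainbow-on-base W P-path (⊆-reflexive (inner-cons-▷ AdjC (inj₁ refl) (lift P) (inj₁ refl)))
    where W = cons (inj₁ refl) (lift P ▷ inj₁ refl)

  canonical-onto : Edge G → ∀ i → Σ V λ v → canonical v ≡ i
  canonical-onto e i with splitAt m i in eq
  ... | inj₁ a = inj₁ a , splitAt⁻¹-↑ˡ eq
  ... | inj₂ z = inj₂ (e , z) , splitAt⁻¹-↑ʳ eq

  ↑ˡ≢↑ʳ : ∀ {a : Fin m} {z : Fin n} → a ↑ˡ n ≢ m ↑ʳ z
  ↑ˡ≢↑ʳ {a} {z} eq with trans (sym (splitAt-↑ˡ m a n)) (trans (cong (splitAt m) eq) (splitAt-↑ʳ m n z))
  ... | ()

  end? : ∀ a (e : Edge G) → Dec (IsEnd {G = G} a e)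
  end? a ((i , j) , _) = (a ≟ᶠ i) ⊎-dec (a ≟ᶠ j)

  -- The colour class of a base vertex w is {w}: an end w of e lies at distance 1
  -- from the copy of e and at distance at least 2 from the copy of any f ∌ w.
  copies-separated : ∀ {e z f z′ w} → IsEnd {G = G} w e → ¬ IsEnd {G = G} w f →
                     ¬ SameCode AdjC canonical (inj₂ (e , z)) (inj₂ (f , z′))
  copies-separated {f = f} {z′} {w} w∈e w∉f same with same (w ↑ˡ n)
  ... | d , (_ , nearest) , ((x , cx , (q , _ , refl) , _) , _) =
    far x cx q (nearest (inj₁ w) 1 refl (Dist-adjacent AdjC w∈e λ ()))
    where
    one-step : (q : Walk AdjC (inj₂ (f , z′)) (inj₁ w)) → len AdjC q ≤ 1 → ⊥
    one-step (cons h nil) _ = w∉f h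
    one-step (cons _ (cons _ _)) (s≤s ())
    far : ∀ x → canonical x ≡ w ↑ˡ n → (q : Walk AdjC (inj₂ (f , z′)) x) → len AdjC q ≤ 1 → ⊥
    far (inj₂ _) cx _ _ = ↑ˡ≢↑ʳ (sym cx)
    far (inj₁ w′) cx q with ↑ˡ-injective n w′ w cx
    ... | refl = one-step q

  canonical-distinct : ∀ u v → SameCode AdjC canonical u v → u ≡ v
  canonical-distinct (inj₁ a) (inj₁ b) same = cong inj₁ (↑ˡ-injective n a b (SameCode⇒≡colour AdjC canonical same))
  canonical-distinct (inj₁ _) (inj₂ _) same = contradiction (SameCode⇒≡colour AdjC canonical same) ↑ˡ≢↑ʳ
  canonical-distinct (inj₂ _) (inj₁ _) same = contradiction (sym (SameCode⇒≡colour AdjC canonical same)) ↑ˡ≢↑ʳ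
  canonical-distinct (inj₂ (((a , b) , t) , z)) (inj₂ (f , z′)) same
    with ↑ʳ-injective m z z′ (SameCode⇒≡colour AdjC canonical same) | end? a f | end? b f
  ... | refl | yes a∈f | yes b∈f = cong (λ e → inj₂ (e , z)) (ends⇒≡ t f a∈f b∈f)
  ... | refl | no a∉f | _ = contradiction same (copies-separated (inj₁ refl) a∉f)
  ... | refl | yes _ | no b∉f = contradiction same (copies-separated (inj₂ refl) b∉f)

  canonical-locating : (∀ a b → Σ (Walk AdjG a b) (IsPath AdjG)) → Edge G →
                       LocatingRainbowColoring AdjC (m + n) canonical
  canonical-locating paths e = canonical-rainbow paths , canonical-onto e , canonical-distinct

edge-of-connected : ∀ {m} (G : SimpleGraph m) → 2 ≤ m → Connected (Adjᴳ G) → Edge G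
edge-of-connected {suc (suc m)} G (s≤s (s≤s _)) connected = first-edge (connected zero (suc zero))
  where
  first-edge : Walk (Adjᴳ G) zero (suc zero) → Edge G
  first-edge (cons {w = zero} h _) = contradiction (trans (sym h) (adj-irr G zero)) λ ()
  first-edge (cons {w = suc w} h _) = (zero , suc w) , subst T (sym h) tt

∈⇒≤sum : ∀ {k ks} → k ∈ ks → k ≤ sum ks
∈⇒≤sum {ks = k ∷ ks} (here refl) = m≤m+n k (sum ks)
∈⇒≤sum {ks = k ∷ ks} (there k∈ks) = ≤-trans (∈⇒≤sum k∈ks) (m≤n+m (sum ks) k)

numEdges-positive : ∀ {m} (G : SimpleGraph m) → Edge G → 1 ≤ numEdges G
numEdges-positive {m} G ((i , j) , t) =
  ≤-trans (indicator t) (≤-trans (∈⇒≤sum (∈-map⁺ _ (∈-allFin j))) (∈⇒≤sum (∈-map⁺ _ (∈-allFin i))))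
  where
  indicator : ∀ {b} → T b → 1 ≤ (if b then 1 else 0)
  indicator {true} _ = ≤-refl

mainTheorem4 : ∀ (m n : ℕ) → 2 ≤ m → 2 ≤ n → (G : SimpleGraph m) →
    Connected (Adjᴳ G) → ∀ (r l : ℕ) →
    IsRvc (Adjᴳ G) r → IsRvcl (CoronaAdjK G n) l →
    (r ⊔ suc n) ≤ l × l ≤ m + n + numEdges G ∸ 1
mainTheorem4 m n 2≤m 2≤n G connected r l (_ , _ , rvc-least) (0<l , (c , locating) , rvcl-least) =
  ⊔-lub r≤l (n<colours locating e) , ≤-trans l≤m+n m+n≤bound
  where
  open Corona G n
  e : Edge G
  e = edge-of-connected G 2≤m connected
  paths : ∀ a b → Σ (Walk AdjG a b) (IsPath AdjG)
  paths a b = walk⇒path AdjG _≟ᶠ_ (connected a b)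
  r≤l : r ≤ l
  r≤l = rvc-least l 0<l (c ∘ inj₁ , rainbow-restrict c (proj₁ locating))
  l≤m+n : l ≤ m + n
  l≤m+n = rvcl-least (m + n) (≤-trans (s≤s z≤n) (≤-trans 2≤n (m≤n+m n m)))
                     (canonical , canonical-locating paths e)
  m+n≤bound : m + n ≤ m + n + numEdges G ∸ 1
  m+n≤bound = subst (m + n ≤_) (sym (+-∸-assoc (m + n) (numEdges-positive G e))) (m≤m+n _ _)
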